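{- For every permutation $\pi$, the tier $t(\pi)$ of $\pi$ under the multi-pass stack sorting algorithm equals the number of separated pairs in $\pi$.
   Context: Permutations are sequences $\pi=\pi_1\cdots\pi_n$ of the values $1,\dots,n$. Multi-pass stack sorting: in a pass, the entries of the current input are pushed one at a time, in order, onto a stack; whenever the top of the stack is the next value needed for the output (the smallest value not yet output), it is popped to the output (repeatedly, as long as this holds). Entries are never popped otherwise. When all input entries have been pushed and no pop is possible, if the stack is nonempty the pass ends and the entries remaining in the stack are returned to the input in their original relative order (reading the stack from bottom to top), and a new pass begins. A permutation is $k$-pass sortable if this procedure outputs $1,2,\dots,n$ using at most $k$ passes. The tier $t(\pi)$ is one less than the minimum number of passes needed to sort $\pi$. For $1\le i\le n-1$, the pair $(i+1,i)$ is a separated pair of $\pi$ if $\pi$ contains a subsequence $(i+1,k,i)$ (in this order of positions) with $k>i+1$. -}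

module Defs where

open import Data.Nat using (ℕ; zero; suc; _<_; _<?_; _≤_; _∸_)
open import Data.Nat.Properties using (_≟_)
open import Data.List using (List; []; _∷_; _++_; reverse; map; upTo; filter; length)
open import Data.List.Relation.Binary.Permutation.Propositional using (_↭_)
open import Data.List.Relation.Binary.Sublist.Propositional using (_⊆_)
open import Data.List.Relation.Binary.Sublist.DecPropositional _≟_ using (_⊆?_)
open import Data.List.Relation.Binary.Sublist.Propositional.Properties using (Any-resp-⊆)
open import Data.List.Relation.Unary.Any using (Any; here; there; any?; satisfied)
open import Data.List.Membership.Propositional using (_∈_)
open import Data.Product using (Σ; ∃; ∃-syntax; _×_; _,_; proj₁; proj₂)
open import Data.Bool using (if_then_else_)
open import Relation.Nullary using (Dec; yes; no; _×-dec_; ¬_)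
open import Relation.Nullary.Decidable using (⌊_⌋)
open import Relation.Binary.PropositionalEquality using (_≡_; refl)

IsPermutation : ℕ → List ℕ → Set
IsPermutation n π = π ↭ map suc (upTo n)

-- Stacks are lists with the TOP of the stack at the head.
-- `next` is the next value needed for the output (smallest not yet output).

record State : Set where
  constructor st
  field
    next  : ℕ
    stack : List ℕ
    out   : List ℕ

popAll : ℕ → List ℕ → List ℕ → State
popAll nx []      o = st nx [] o
popAll nx (x ∷ s) o =
  if ⌊ x ≟ nx ⌋ then popAll (suc nx) s (o ++ (x ∷ [])) else st nx (x ∷ s) o

pushAll : List ℕ → State → State
pushAll []       s          = s
pushAll (x ∷ xs) (st nx s o) = pushAll xs (popAll nx (x ∷ s) o)

record Config : Set where
  constructor cfg
  field
    input : List ℕ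
    nextV : ℕ
    output : List ℕ

-- one pass: push everything; the remaining stack, read bottom to top,
-- becomes the new input
pass : Config → Config
pass (cfg inp nx o) with pushAll inp (st nx [] o)
... | st nx′ s o′ = cfg (reverse s) nx′ o′

passes : ℕ → List ℕ → Config
passes zero    π = cfg π 1 []
passes (suc k) π = pass (passes k π)

KPassSortable : ℕ → ℕ → List ℕ → Set
KPassSortable k n π =
  ∃[ j ] (j ≤ k × Config.output (passes j π) ≡ map suc (upTo n)
               × Config.input (passes j π) ≡ [])

-- tier t(π) = (minimum number of passes needed) - 1, i.e.
-- t(π) = t  iff  π is (t+1)-pass sortable but not t-pass sortable.
HasTier : ℕ → List ℕ → ℕ → Set
HasTier n π t = KPassSortable (suc t) n π × ¬ KPassSortable t n π

SeparatedPair : List ℕ → ℕ → Set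
SeparatedPair π i = ∃[ k ] (suc i < k × (suc i ∷ k ∷ i ∷ []) ⊆ π)

separatedPair? : (π : List ℕ) → (i : ℕ) → Dec (SeparatedPair π i)
separatedPair? π i with any? (λ k → (suc i <? k) ×-dec ((suc i ∷ k ∷ i ∷ []) ⊆? π)) π
... | yes a = yes (satisfied a)
... | no ¬a = no λ { (k , lt , sub) →
                 ¬a (Data.List.Relation.Unary.Any.map
                       {P = λ x → x ≡ k} {Q = λ x → suc i < x × (suc i ∷ x ∷ i ∷ []) ⊆ π}
                       (λ { refl → lt , sub })
                       (Any-resp-⊆ sub (there (here refl)))) }

numSeparatedPairs : ℕ → List ℕ → ℕ
numSeparatedPairs n π = length (filter (separatedPair? π) (map suc (upTo (n ∸ 1))))

-- The pass that starts with 1, …, m already output pushes the entries of π above m in order.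
-- After i is popped, i+1 follows it in the same pass unless i+1 is already on the stack
-- under a larger entry K, pushed between i+1 and i: this is exactly a pattern (i+1, K, i).
-- So the pass outputs up to the first i > m with (i+1, i) separated (or up to n), leaving
-- as input the entries of π above i in their original order. Every pass but the last thus
-- stops at one separated pair, and π needs exactly one pass more than it has separated pairs.
module Submission where

open import Defs
open import Data.Nat using (ℕ; zero; suc; _+_; _∸_; _≤_; _<_; _≤′_; ≤′-refl; ≤′-step; _≤?_; _<?_; z≤n; s≤s; s≤s⁻¹)
open import Data.Nat.Properties
open import Data.List using (List; []; _∷_; _++_; [_]; reverse; reverseAcc; map; upTo; applyUpTo; filter; length)
open import Data.List.Properties
  using (filter-accept; filter-reject; filter-all; filter-none; filter-++; unfold-reverse; reverse-++;
         reverse-involutive; map-++; upTo-∷ʳ; map-upTo; length-map; length-upTo; ∷-injectiveˡ)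
open import Data.List.Membership.Propositional using (_∈_; _∉_)
open import Data.List.Membership.Propositional.Properties
  using (∈-filter⁺; ∈-filter⁻; ∈-map⁺; ∈-map⁻; ∈-upTo⁺; ∈-upTo⁻)
open import Data.List.Relation.Unary.All as All using (All; []; _∷_)
open import Data.List.Relation.Unary.All.Properties using (¬Any⇒All¬)
open import Data.List.Relation.Unary.Any as Any using (here; there)
open import Data.List.Relation.Unary.Any.Properties
  using () renaming (reverse⁺ to ∈-reverse⁺; reverse⁻ to ∈-reverse⁻)
open import Data.List.Relation.Unary.AllPairs using ([]; _∷_)
open import Data.List.Relation.Unary.Unique.Propositional using (Unique)
import Data.List.Relation.Unary.Unique.Propositional.Properties as Unique
open import Data.List.Relation.Binary.Sublist.Propositional using (_⊆_; _∷_; _∷ʳ_; from∈; ⊆-trans)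
open import Data.List.Relation.Binary.Sublist.Propositional.Properties
  using (Any-resp-⊆; ∷ˡ⁻; filter⁺; filter-⊆; reverse⁺)
open import Data.List.Relation.Binary.Permutation.Propositional using (↭-sym; ↭⇒↭ₛ)
open import Data.List.Relation.Binary.Permutation.Propositional.Properties using (∈-resp-↭)
import Data.List.Relation.Binary.Permutation.Setoid.Properties as Permutation
open import Data.Product using (∃-syntax; _×_; _,_; proj₁; proj₂)
open import Data.Sum using (inj₁; inj₂)
open import Function using (_∘_; case_of_)
open import Relation.Nullary using (¬_; Dec; yes; no; contradiction)
open import Relation.Nullary.Decidable using (dec-no)
open import Relation.Unary using (Pred; Decidable)
open import Relation.Binary.PropositionalEquality hiding ([_])
open import Relation.Binary.PropositionalEquality.Properties using (setoid)

module _ {a p q} {A : Set a} {P : Pred A p} {Q : Pred A q} (P? : Decidable P) (Q? : Decidable Q) where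

  filter-filter-⇒ : (∀ {x} → Q x → P x) → ∀ xs → filter Q? (filter P? xs) ≡ filter Q? xs
  filter-filter-⇒ Q⇒P [] = refl
  filter-filter-⇒ Q⇒P (x ∷ xs) = by-cases (Q? x)
    where
    open ≡-Reasoning
    IH : filter Q? (filter P? xs) ≡ filter Q? xs
    IH = filter-filter-⇒ Q⇒P xs
    by-cases : Dec (Q x) → filter Q? (filter P? (x ∷ xs)) ≡ filter Q? (x ∷ xs)
    by-cases (yes qx) = begin
      filter Q? (filter P? (x ∷ xs))  ≡⟨ cong (filter Q?) (filter-accept P? (Q⇒P qx)) ⟩
      filter Q? (x ∷ filter P? xs)    ≡⟨ filter-accept Q? qx ⟩
      x ∷ filter Q? (filter P? xs)    ≡⟨ cong (x ∷_) IH ⟩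
      x ∷ filter Q? xs                ≡⟨ filter-accept Q? qx ⟨
      filter Q? (x ∷ xs)              ∎
    by-cases (no ¬qx) = begin
      filter Q? (filter P? (x ∷ xs))  ≡⟨ drop-x (P? x) ⟩
      filter Q? (filter P? xs)        ≡⟨ IH ⟩
      filter Q? xs                    ≡⟨ filter-reject Q? ¬qx ⟨
      filter Q? (x ∷ xs)              ∎
      where
      drop-x : Dec (P x) → filter Q? (filter P? (x ∷ xs)) ≡ filter Q? (filter P? xs)
      drop-x (yes px) = trans (cong (filter Q?) (filter-accept P? px)) (filter-reject Q? ¬qx)
      drop-x (no ¬px) = cong (filter Q?) (filter-reject P? ¬px)

module _ {a p} {A : Set a} {P : Pred A p} (P? : Decidable P) where

  reverse-filter-[x] : ∀ x → reverse (filter P? [ x ]) ≡ filter P? [ x ]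
  reverse-filter-[x] x with P? x
  ... | yes _ = refl
  ... | no _  = refl

  filter-reverse : ∀ xs → filter P? (reverse xs) ≡ reverse (filter P? xs)
  filter-reverse [] = refl
  filter-reverse (x ∷ xs) = begin
    filter P? (reverse (x ∷ xs))                         ≡⟨ cong (filter P?) (unfold-reverse x xs) ⟩
    filter P? (reverse xs ++ [ x ])                      ≡⟨ filter-++ P? (reverse xs) [ x ] ⟩
    filter P? (reverse xs) ++ filter P? [ x ]            ≡⟨ cong₂ _++_ (filter-reverse xs) (sym (reverse-filter-[x] x)) ⟩
    reverse (filter P? xs) ++ reverse (filter P? [ x ])  ≡⟨ sym (reverse-++ (filter P? [ x ]) (filter P? xs)) ⟩
    reverse (filter P? [ x ] ++ filter P? xs)            ≡⟨ cong reverse (sym (filter-++ P? [ x ] xs)) ⟩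
    reverse (filter P? (x ∷ xs))                         ∎
    where open ≡-Reasoning

atLeast : ℕ → List ℕ → List ℕ
atLeast c = filter (c ≤?_)

atLeast-accept : ∀ {c y} q → c ≤ y → atLeast c (y ∷ q) ≡ y ∷ atLeast c q
atLeast-accept q = filter-accept (_ ≤?_)

atLeast-reject : ∀ {c y} q → y < c → atLeast c (y ∷ q) ≡ atLeast c q
atLeast-reject q y<c = filter-reject (_ ≤?_) (<⇒≱ y<c)

∈-atLeast⁻ : ∀ {c x} q → x ∈ atLeast c q → x ∈ q × c ≤ x
∈-atLeast⁻ q = ∈-filter⁻ (_ ≤?_)

atLeast-atLeast : ∀ {a b} → a ≤ b → ∀ w → atLeast b (atLeast a w) ≡ atLeast b w
atLeast-atLeast a≤b = filter-filter-⇒ (_ ≤?_) (_ ≤?_) (≤-trans a≤b)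

reverse-atLeast-reverse : ∀ c w → reverse (atLeast c (reverse w)) ≡ atLeast c w
reverse-atLeast-reverse c w = begin
  reverse (atLeast c (reverse w))    ≡⟨ cong reverse (filter-reverse (c ≤?_) w) ⟩
  reverse (reverse (atLeast c w))    ≡⟨ reverse-involutive (atLeast c w) ⟩
  atLeast c w                        ∎
  where open ≡-Reasoning

⊆-atLeast : ∀ {c xs ys} → All (c ≤_) xs → xs ⊆ ys → xs ⊆ atLeast c ys
⊆-atLeast {c} {xs} {ys} c≤xs xs⊆ys =
  subst (_⊆ atLeast c ys) (filter-all (c ≤?_) c≤xs)
        (filter⁺ (c ≤?_) (c ≤?_) (λ { refl c≤x → c≤x }) xs⊆ys)

atLeast-pop : ∀ {c q s} → Unique q → atLeast c q ≡ c ∷ s → atLeast (suc c) q ≡ s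
atLeast-pop {c} {q} {s} uq eq = begin
  atLeast (suc c) q                ≡⟨ sym (atLeast-atLeast (n≤1+n c) q) ⟩
  atLeast (suc c) (atLeast c q)    ≡⟨ cong (atLeast (suc c)) eq ⟩
  atLeast (suc c) (c ∷ s)          ≡⟨ atLeast-reject s ≤-refl ⟩
  atLeast (suc c) s                ≡⟨ filter-all (suc c ≤?_) (All.tabulate c<) ⟩
  s                                ∎
  where
  open ≡-Reasoning
  unique : Unique (c ∷ s)
  unique = subst Unique eq (Unique.filter⁺ (c ≤?_) uq)
  c< : ∀ {x} → x ∈ s → c < x
  c< x∈s = ≤∧≢⇒< (proj₂ (∈-atLeast⁻ q (subst (_ ∈_) (sym eq) (there x∈s))))
                 (λ { refl → Unique.Unique[x∷xs]⇒x∉xs unique x∈s })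

-- A pass stores the entries pushed so far latest first; then `atLeast c q` is
-- exactly the stack while c is the next value to be output.
OnTop : ℕ → List ℕ → Set
OnTop c q = ∃[ s ] atLeast c q ≡ c ∷ s

onTop-∷⁺ : ∀ {c y} q → y < c → OnTop c q → OnTop c (y ∷ q)
onTop-∷⁺ q y<c (s , eq) = s , trans (atLeast-reject q y<c) eq

onTop-∷⁻ : ∀ {c y} q → y < c → OnTop c (y ∷ q) → OnTop c q
onTop-∷⁻ q y<c (s , eq) = s , trans (sym (atLeast-reject q y<c)) eq

onTop-∈ : ∀ {c q} → OnTop c q → c ∈ q
onTop-∈ {q = q} (s , eq) = proj₁ (∈-atLeast⁻ q (subst (_ ∈_) (sym eq) (here refl)))

-- The separated pair (i+1, i) read in a list of pushed entries, latest first.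
SeparatedPairʳ : List ℕ → ℕ → Set
SeparatedPairʳ q i = ∃[ K ] (suc i < K × (i ∷ K ∷ suc i ∷ []) ⊆ q)

separatedPairʳ-∷⁻ : ∀ {x i q} → x ≢ i → SeparatedPairʳ (x ∷ q) i → SeparatedPairʳ q i
separatedPairʳ-∷⁻ x≢i (K , lt , _ ∷ʳ sub)   = K , lt , sub
separatedPairʳ-∷⁻ x≢i (K , lt , refl ∷ sub) = contradiction refl x≢i

onTop⇒¬separatedʳ : ∀ {i q} → Unique q → OnTop (suc i) q → ¬ SeparatedPairʳ q i
onTop⇒¬separatedʳ {i} {q} uq (s , eq) (K , i+1<K , sub) =
  Unique.Unique[x∷xs]⇒x∉xs unique i+1∈s
  where
  unique : Unique (suc i ∷ s)
  unique = subst Unique eq (Unique.filter⁺ (suc i ≤?_) uq)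
  i+1∈s : suc i ∈ s
  i+1∈s with subst ((K ∷ suc i ∷ []) ⊆_) eq (⊆-atLeast (<⇒≤ i+1<K ∷ ≤-refl ∷ []) (∷ˡ⁻ sub))
  ... | _ ∷ʳ sub′   = Any-resp-⊆ sub′ (there (here refl))
  ... | refl ∷ sub′ = contradiction refl (<⇒≢ i+1<K)

¬onTop⇒covered : ∀ {d q} → d ∈ q → ¬ OnTop d q → ∃[ K ] (d < K × (K ∷ d ∷ []) ⊆ q)
¬onTop⇒covered {d} {z ∷ q} d∈ ¬top with d ≤? z
... | yes d≤z = z , ≤∧≢⇒< d≤z d≢z , refl ∷ from∈ (Any.tail d≢z d∈)
  where
  d≢z : d ≢ z
  d≢z refl = ¬top (atLeast d q , atLeast-accept q ≤-refl)
... | no d≰z with ¬onTop⇒covered (Any.tail (λ { refl → d≰z ≤-refl }) d∈)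
                   (¬top ∘ onTop-∷⁺ q (≰⇒> d≰z))
...   | K , d<K , sub = K , d<K , z ∷ʳ sub

onTop-blocked⇒separatedʳ : ∀ {c q} → OnTop c q → ¬ OnTop (suc c) q → suc c ∈ q → SeparatedPairʳ q c
onTop-blocked⇒separatedʳ {c} {y ∷ q} (s , eq) ¬top c+1∈ with c ≤? y
... | no c≰y with onTop-blocked⇒separatedʳ (onTop-∷⁻ q (≰⇒> c≰y) (s , eq))
                    (¬top ∘ onTop-∷⁺ q (m<n⇒m<1+n (≰⇒> c≰y)))
                    (Any.tail (λ { refl → <-asym (≰⇒> c≰y) (n<1+n c) }) c+1∈)
...   | K , lt , sub = K , lt , y ∷ʳ sub
onTop-blocked⇒separatedʳ {c} {y ∷ q} (s , eq) ¬top c+1∈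
    | yes c≤y with ∷-injectiveˡ (trans (sym (atLeast-accept q c≤y)) eq)
...   | refl with ¬onTop⇒covered (Any.tail (λ c+1≡c → <⇒≢ (n<1+n c) (sym c+1≡c)) c+1∈)
                   (¬top ∘ onTop-∷⁺ q ≤-refl)
...     | K , lt , sub = K , lt , refl ∷ sub

oneTo : ℕ → List ℕ
oneTo k = map suc (upTo k)

length-oneTo : ∀ k → length (oneTo k) ≡ k
length-oneTo k = trans (length-map suc (upTo k)) (length-upTo k)

oneTo-++ : ∀ k → oneTo k ++ [ suc k ] ≡ oneTo (suc k)
oneTo-++ k = trans (sym (map-++ suc (upTo k) [ k ])) (cong (map suc) (upTo-∷ʳ k))

popAll-hit : ∀ c s o → popAll c (c ∷ s) o ≡ popAll (suc c) s (o ++ [ c ])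
popAll-hit c s o rewrite ≟-diag {c} refl = refl

popAll-miss : ∀ {y c} s o → y ≢ c → popAll c (y ∷ s) o ≡ st c (y ∷ s) o
popAll-miss {y} {c} s o y≢c rewrite dec-no (y ≟ c) y≢c = refl

record Cascade (q : List ℕ) (k : ℕ) (s : List ℕ) : Set where
  field
    k′          : ℕ
    k≤k′        : k ≤ k′
    popAll≡     : popAll (suc k) s (oneTo k) ≡ st (suc k′) (atLeast (suc k′) q) (oneTo k′)
    poppedOnTop : ∀ i → k ≤ i → i < k′ → OnTop (suc i) q
    stuck       : ¬ OnTop (suc k′) q

  advances : OnTop (suc k) q → k < k′
  advances top = ≤∧≢⇒< k≤k′ (λ k≡k′ → stuck (subst (λ j → OnTop (suc j) q) k≡k′ top))

  lastOnTop : k < k′ → OnTop k′ q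
  lastOnTop = last k′ poppedOnTop
    where
    last : ∀ j → (∀ i → k ≤ i → i < j → OnTop (suc i) q) → k < j → OnTop j q
    last (suc i) onTop (s≤s k≤i) = onTop i k≤i ≤-refl

cascade : ∀ {q} → Unique q → ∀ k s → atLeast (suc k) q ≡ s → Cascade q k s
cascade {q} uq k [] eq = record
  { k′ = k ; k≤k′ = ≤-refl ; popAll≡ = cong (λ s → st (suc k) s (oneTo k)) (sym eq)
  ; poppedOnTop = λ i k≤i i<k → contradiction (≤-<-trans k≤i i<k) (<-irrefl refl)
  ; stuck = λ { (s , eq′) → case trans (sym eq) eq′ of λ () } }
cascade {q} uq k (y ∷ s) eq with y ≟ suc k
... | no y≢k+1 = record
  { k′ = k ; k≤k′ = ≤-refl
  ; popAll≡ = trans (popAll-miss s (oneTo k) y≢k+1) (cong (λ s → st (suc k) s (oneTo k)) (sym eq))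
  ; poppedOnTop = λ i k≤i i<k → contradiction (≤-<-trans k≤i i<k) (<-irrefl refl)
  ; stuck = λ { (s′ , eq′) → y≢k+1 (∷-injectiveˡ (trans (sym eq) eq′)) } }
... | yes refl = record
  { k′ = k′ ; k≤k′ = ≤-trans (n≤1+n k) k≤k′
  ; popAll≡ = begin
      popAll (suc k) (suc k ∷ s) (oneTo k)            ≡⟨ popAll-hit (suc k) s (oneTo k) ⟩
      popAll (suc (suc k)) s (oneTo k ++ [ suc k ])   ≡⟨ cong (popAll (suc (suc k)) s) (oneTo-++ k) ⟩
      popAll (suc (suc k)) s (oneTo (suc k))          ≡⟨ popAll≡ ⟩
      st (suc k′) (atLeast (suc k′) q) (oneTo k′)     ∎
  ; poppedOnTop = onTop
  ; stuck = stuck }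
  where
  open ≡-Reasoning
  open Cascade (cascade uq (suc k) s (atLeast-pop uq eq))
  onTop : ∀ i → k ≤ i → i < k′ → OnTop (suc i) q
  onTop i k≤i i<k′ with k ≟ i
  ... | yes refl = s , eq
  ... | no k≢i = poppedOnTop i (≤∧≢⇒< k≤i k≢i) i<k′

-- A pass begun when 1, …, m had been output, after pushing the entries of
-- reverse q, with xs still to be pushed and 1, …, k output so far; the stack
-- is then atLeast (suc k) q.
record PushInvariant (m : ℕ) (q xs : List ℕ) (k : ℕ) : Set where
  field
    m≤k         : m ≤ k
    started     : suc m ∈ q → m < k
    popped      : ∀ v → m < v → v ≤ k → v ∈ q
    unseparated : ∀ i → m < i → i < k → ¬ SeparatedPairʳ q i
    blocked     : m < k → suc k ∈ q → SeparatedPairʳ q k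
    unique-q    : Unique q
    unique-xs   : Unique xs
    disjoint    : ∀ {v} → v ∈ xs → v ∉ q
    above-m     : All (m <_) xs

push-step : ∀ {m q x xs k} → PushInvariant m q (x ∷ xs) k →
  ∃[ k′ ] (popAll (suc k) (x ∷ atLeast (suc k) q) (oneTo k)
             ≡ st (suc k′) (atLeast (suc k′) (x ∷ q)) (oneTo k′)
           × PushInvariant m (x ∷ q) xs k′)
push-step {m} {q} {x} {xs} {k} I = k′ , popAll≡ , record
  { m≤k         = ≤-trans m≤k k≤k′
  ; started     = started′
  ; popped      = popped′
  ; unseparated = unseparated′
  ; blocked     = blocked′
  ; unique-q    = unique
  ; unique-xs   = Unique.drop⁺ 1 unique-xs
  ; disjoint    = disjoint′
  ; above-m     = All.tail above-m
  }
  where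
  open PushInvariant I
  k<x : k < x
  k<x = ≰⇒> (λ x≤k → disjoint (here refl) (popped x (All.head above-m) x≤k))
  unique : Unique (x ∷ q)
  unique = ¬Any⇒All¬ q (disjoint (here refl)) ∷ unique-q
  open Cascade (cascade unique k (x ∷ atLeast (suc k) q) (atLeast-accept q k<x))
  pushed-next : x ≡ suc k → k < k′
  pushed-next refl = advances (atLeast (suc k) q , atLeast-accept q ≤-refl)

  started′ : suc m ∈ x ∷ q → m < k′
  started′ (here refl) = ≤-<-trans m≤k (pushed-next (cong suc (≤-antisym m≤k (s≤s⁻¹ k<x))))
  started′ (there m+1∈q) = <-≤-trans (started m+1∈q) k≤k′

  popped′ : ∀ v → m < v → v ≤ k′ → v ∈ x ∷ q
  popped′ v m<v v≤k′ with v ≤? k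
  popped′ v       m<v v≤k′ | yes v≤k = there (popped v m<v v≤k)
  popped′ zero    m<v v≤k′ | no v≰k  = contradiction z≤n v≰k
  popped′ (suc i) m<v i<k′ | no v≰k  = onTop-∈ (poppedOnTop i (s≤s⁻¹ (≰⇒> v≰k)) i<k′)

  unseparated′ : ∀ i → m < i → i < k′ → ¬ SeparatedPairʳ (x ∷ q) i
  unseparated′ i m<i i<k′ with i <? k
  ... | yes i<k = unseparated i m<i i<k ∘ separatedPairʳ-∷⁻ (λ { refl → <-asym i<k k<x })
  ... | no i≮k  = onTop⇒¬separatedʳ unique (poppedOnTop i (≮⇒≥ i≮k) i<k′)

  blocked′ : m < k′ → suc k′ ∈ x ∷ q → SeparatedPairʳ (x ∷ q) k′
  blocked′ m<k′ k′+1∈ with k <? k′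
  ... | yes k<k′ = onTop-blocked⇒separatedʳ (lastOnTop k<k′) stuck k′+1∈
  ... | no k≮k′ =
    subst (SeparatedPairʳ (x ∷ q)) (sym k′≡k) (still (subst (λ j → suc j ∈ x ∷ q) k′≡k k′+1∈))
    where
    k′≡k : k′ ≡ k
    k′≡k = ≤-antisym (≮⇒≥ k≮k′) k≤k′
    still : suc k ∈ x ∷ q → SeparatedPairʳ (x ∷ q) k
    still (here k+1≡x)  = contradiction (pushed-next (sym k+1≡x)) k≮k′
    still (there k+1∈q) with blocked (subst (m <_) k′≡k m<k′) k+1∈q
    ... | K , lt , sub = K , lt , x ∷ʳ sub

  disjoint′ : ∀ {v} → v ∈ xs → v ∉ x ∷ q
  disjoint′ v∈xs (here refl) = Unique.Unique[x∷xs]⇒x∉xs unique-xs v∈xs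
  disjoint′ v∈xs (there v∈q) = disjoint (there v∈xs) v∈q

push-all : ∀ {m} xs {q k} → PushInvariant m q xs k →
  ∃[ k′ ] (pushAll xs (st (suc k) (atLeast (suc k) q) (oneTo k))
             ≡ st (suc k′) (atLeast (suc k′) (reverseAcc q xs)) (oneTo k′)
           × PushInvariant m (reverseAcc q xs) [] k′)
push-all []       I = _ , refl , I
push-all (x ∷ xs) I with push-step I
... | _ , popAll≡ , I′ with push-all xs I′
...   | k′ , pushAll≡ , I″ = k′ , trans (cong (pushAll xs) popAll≡) pushAll≡ , I″

interval : ℕ → ℕ → List ℕ
interval c zero    = []
interval c (suc d) = c ∷ interval (suc c) d

applyUpTo-interval : ∀ f c → (∀ i → f i ≡ c + i) → ∀ d → applyUpTo f d ≡ interval c d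
applyUpTo-interval f c f≗c+ zero    = refl
applyUpTo-interval f c f≗c+ (suc d) =
  cong₂ _∷_ (trans (f≗c+ 0) (+-identityʳ c))
            (applyUpTo-interval (f ∘ suc) (suc c) (λ i → trans (f≗c+ (suc i)) (+-suc c i)) d)

oneTo-interval : ∀ d → oneTo d ≡ interval 1 d
oneTo-interval d = trans (map-upTo suc d) (applyUpTo-interval suc 1 (λ _ → refl) d)

pass-result : ∀ {inp nx o nx′ s o′} → pushAll inp (st nx [] o) ≡ st nx′ s o′ →
              pass (cfg inp nx o) ≡ cfg (reverse s) nx′ o′
pass-result eq rewrite eq = refl

module Sorting (n : ℕ) (π : List ℕ) (perm : IsPermutation n π) where

  unique-π : Unique π
  unique-π = Permutation.Unique-resp-↭ (setoid ℕ) (↭⇒↭ₛ (↭-sym perm))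
               (Unique.map⁺ suc-injective (Unique.upTo⁺ n))

  ∈π⇒bounded : ∀ {x} → x ∈ π → 0 < x × x ≤ n
  ∈π⇒bounded x∈π with ∈-map⁻ suc (∈-resp-↭ perm x∈π)
  ... | _ , y∈ , refl = s≤s z≤n , ∈-upTo⁻ y∈

  bounded⇒∈π : ∀ {v} → v < n → suc v ∈ π
  bounded⇒∈π v<n = ∈-resp-↭ (↭-sym perm) (∈-map⁺ suc (∈-upTo⁺ v<n))

  stage : ℕ → Config
  stage m = cfg (atLeast (suc m) π) (suc m) (oneTo m)

  record PassResult (m : ℕ) : Set where
    field
      m′          : ℕ
      pass≡       : pass (stage m) ≡ stage m′
      m<m′        : m < m′
      m′≤n        : m′ ≤ n
      unseparated : ∀ i → m < i → i < m′ → ¬ SeparatedPair π i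
      separated   : m′ < n → SeparatedPair π m′

  module _ (m : ℕ) where

    private
      w = atLeast (suc m) π

    initial-invariant : PushInvariant m [] w m
    initial-invariant = record
      { m≤k         = ≤-refl
      ; started     = λ ()
      ; popped      = λ v m<v v≤m → contradiction m<v (≤⇒≯ v≤m)
      ; unseparated = λ i m<i i<m → contradiction m<i (<⇒≯ i<m)
      ; blocked     = λ m<m → contradiction m<m (<-irrefl refl)
      ; unique-q    = []
      ; unique-xs   = Unique.filter⁺ (suc m ≤?_) unique-π
      ; disjoint    = λ _ ()
      ; above-m     = All.tabulate (λ v∈w → proj₂ (∈-atLeast⁻ π v∈w))
      }

    ∈reverse-w : ∀ {v} → m ≤ v → v < n → suc v ∈ reverse w
    ∈reverse-w m≤v v<n = ∈-reverse⁺ (∈-filter⁺ (suc m ≤?_) (bounded⇒∈π v<n) (s≤s m≤v))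

    separated⇒separatedʳ : ∀ {i} → m < i → SeparatedPair π i → SeparatedPairʳ (reverse w) i
    separated⇒separatedʳ {i} m<i (K , i+1<K , sub) =
      K , i+1<K , reverse⁺ (⊆-atLeast (m<i+1 ∷ ≤-trans m<i+1 (<⇒≤ i+1<K) ∷ m<i ∷ []) sub)
      where
      m<i+1 : m < suc i
      m<i+1 = ≤-trans m<i (n≤1+n i)

    separatedʳ⇒separated : ∀ {i} → SeparatedPairʳ (reverse w) i → SeparatedPair π i
    separatedʳ⇒separated (K , i+1<K , sub) =
      K , i+1<K , ⊆-trans (subst (_ ⊆_) (reverse-involutive w) (reverse⁺ sub)) (filter-⊆ (suc m ≤?_) π)

    pass-stage : m < n → PassResult m
    pass-stage m<n with push-all w initial-invariant
    ... | k , pushAll≡ , I = record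
      { m′          = k
      ; pass≡       = trans (pass-result {w} pushAll≡) (cong (λ s → cfg s (suc k) (oneTo k)) remaining)
      ; m<m′        = m<k
      ; m′≤n        = proj₂ (∈π⇒bounded (proj₁ (∈-atLeast⁻ π (∈-reverse⁻ (popped k m<k ≤-refl)))))
      ; unseparated = λ i m<i i<k → unseparated i m<i i<k ∘ separated⇒separatedʳ m<i
      ; separated   = λ k<n → separatedʳ⇒separated (blocked m<k (∈reverse-w m≤k k<n))
      }
      where
      open PushInvariant I
      m<k : m < k
      m<k = started (∈reverse-w ≤-refl m<n)
      remaining : reverse (atLeast (suc k) (reverse w)) ≡ atLeast (suc k) π
      remaining = trans (reverse-atLeast-reverse (suc k) w) (atLeast-atLeast (s≤s m≤k) π)

  separatedCount : ℕ → ℕ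
  separatedCount c = length (filter (separatedPair? π) (interval c (n ∸ c)))

  numSeparatedPairs≡separatedCount : numSeparatedPairs n π ≡ separatedCount 1
  numSeparatedPairs≡separatedCount = cong (length ∘ filter (separatedPair? π)) (oneTo-interval (n ∸ 1))

  separatedCount-unseparated : ∀ {c} → c < n → ¬ SeparatedPair π c →
                               separatedCount c ≡ separatedCount (suc c)
  separatedCount-unseparated {c} c<n ¬sep rewrite +-∸-assoc 1 c<n =
    cong length (filter-reject (separatedPair? π) ¬sep)

  separatedCount-separated : ∀ {c} → c < n → SeparatedPair π c →
                             separatedCount c ≡ suc (separatedCount (suc c))
  separatedCount-separated {c} c<n sep rewrite +-∸-assoc 1 c<n =
    cong length (filter-accept (separatedPair? π) sep)

  separatedCount-n : separatedCount n ≡ 0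
  separatedCount-n rewrite n∸n≡0 n = refl

  separatedCount-skip : ∀ {c c′} → c ≤ c′ → c′ ≤ n → (∀ i → c ≤ i → i < c′ → ¬ SeparatedPair π i) →
                        separatedCount c ≡ separatedCount c′
  separatedCount-skip c≤c′ = skip (≤⇒≤′ c≤c′)
    where
    skip : ∀ {c c′} → c ≤′ c′ → c′ ≤ n → (∀ i → c ≤ i → i < c′ → ¬ SeparatedPair π i) →
           separatedCount c ≡ separatedCount c′
    skip ≤′-refl                _      _   = refl
    skip (≤′-step {c″} c≤′c″) c″<n gap =
      trans (skip c≤′c″ (<⇒≤ c″<n) (λ i c≤i i<c″ → gap i c≤i (m<n⇒m<1+n i<c″)))
            (separatedCount-unseparated c″<n (gap c″ (≤′⇒≤ c≤′c″) ≤-refl))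

  module _ {m : ℕ} (R : PassResult m) where
    open PassResult R

    separatedCount-pass : separatedCount (suc m) ≡ separatedCount m′
    separatedCount-pass = separatedCount-skip m<m′ m′≤n unseparated

    separatedCount-pass-< : m′ < n → separatedCount (suc m) ≡ suc (separatedCount (suc m′))
    separatedCount-pass-< m′<n = trans separatedCount-pass (separatedCount-separated m′<n (separated m′<n))

    separatedCount-pass-≡ : m′ ≡ n → separatedCount (suc m) ≡ 0
    separatedCount-pass-≡ refl = trans separatedCount-pass separatedCount-n

    last-pass : separatedCount (suc m) ≡ 0 → m′ ≡ n
    last-pass none with m′ <? n
    ... | yes m′<n = contradiction (trans (sym (separatedCount-pass-< m′<n)) none) λ ()
    ... | no m′≮n  = ≤-antisym m′≤n (≮⇒≥ m′≮n)

  passes-zero : passes 0 π ≡ stage 0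
  passes-zero = cong (λ w → cfg w 1 []) (sym (filter-all (1 ≤?_) (All.tabulate (proj₁ ∘ ∈π⇒bounded))))

  passes≡stage : 0 < n → ∀ j → j ≤ numSeparatedPairs n π →
    ∃[ m ] (passes j π ≡ stage m × m < n × separatedCount (suc m) + j ≡ numSeparatedPairs n π)
  passes≡stage 0<n zero _ =
    0 , passes-zero , 0<n , trans (+-identityʳ _) (sym numSeparatedPairs≡separatedCount)
  passes≡stage 0<n (suc j) j<t with passes≡stage 0<n j (<⇒≤ j<t)
  ... | m , passes≡ , m<n , count = m′ , trans (cong pass passes≡) pass≡ , m′<n , count′
    where
    R = pass-stage m m<n
    open PassResult R using (m′; pass≡; m′≤n)
    m′<n : m′ < n
    m′<n with m≤n⇒m<n∨m≡n m′≤n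
    ... | inj₁ m′<n = m′<n
    ... | inj₂ m′≡n =
      contradiction j<t (<-irrefl (trans (cong (_+ j) (sym (separatedCount-pass-≡ R m′≡n))) count))
    count′ : separatedCount (suc m′) + suc j ≡ numSeparatedPairs n π
    count′ = trans (+-suc _ j) (trans (cong (_+ j) (sym (separatedCount-pass-< R m′<n))) count)

  sortable : 0 < n → KPassSortable (suc (numSeparatedPairs n π)) n π
  sortable 0<n with passes≡stage 0<n (numSeparatedPairs n π) ≤-refl
  ... | m , passes≡ , m<n , count =
    suc t , ≤-refl , cong Config.output passes≡n , trans (cong Config.input passes≡n) none-left
    where
    t = numSeparatedPairs n π
    R = pass-stage m m<n
    open PassResult R using (m′; pass≡)
    passes≡n : passes (suc t) π ≡ stage n
    passes≡n = begin
      pass (passes t π)  ≡⟨ cong pass passes≡ ⟩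
      pass (stage m)     ≡⟨ pass≡ ⟩
      stage m′           ≡⟨ cong stage (last-pass R (+-cancelʳ-≡ t (separatedCount (suc m)) 0 count)) ⟩
      stage n            ∎
      where open ≡-Reasoning
    none-left : atLeast (suc n) π ≡ []
    none-left = filter-none (suc n ≤?_) (All.tabulate (≤⇒≯ ∘ proj₂ ∘ ∈π⇒bounded))

  unsortable : 0 < n → ¬ KPassSortable (numSeparatedPairs n π) n π
  unsortable 0<n (j , j≤t , sorted , _) with passes≡stage 0<n j j≤t
  ... | m , passes≡ , m<n , _ = <-irrefl m≡n m<n
    where
    m≡n : m ≡ n
    m≡n = begin
      m                                ≡⟨ length-oneTo m ⟨
      length (oneTo m)                 ≡⟨ cong (length ∘ Config.output) passes≡ ⟨
      length (Config.output (passes j π)) ≡⟨ cong length sorted ⟩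
      length (oneTo n)                 ≡⟨ length-oneTo n ⟩
      n                                ∎
      where open ≡-Reasoning

theorem2p4 : (n : ℕ) → 1 ≤ n → (π : List ℕ) → IsPermutation n π →
    HasTier n π (numSeparatedPairs n π)
theorem2p4 n 0<n π perm = sortable 0<n , unsortable 0<n
  where open Sorting n π perm
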